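{- Let $k\ge 4$ be even and let $G$ be a simple graph, possibly with loops. Let $\lambda$ be an $H$-eigenvalue of $\mathcal{A}(G^{k,k/2})$ (respectively, of $\mathcal{Q}(G^{k,k/2})$) with a real eigenvector $x$ that has no zero entries. If $\lambda\neq 0$ in the adjacency case (respectively, $\lambda\notin\{d_{\mathbf{u}}: u\in V(G)\}$ in the signless Laplacian case), then $\lambda$ is an eigenvalue of the adjacency matrix $A(G)$ (respectively, of the signless Laplacian matrix $Q(G)$) with eigenvector $y\in\mathbb{R}^{V(G)}$ given by $y_v=x^{\mathbf{v}}$ for each $v\in V(G)$.
   Context: For a simple graph $G$ possibly with loops (edges consisting of one vertex) and even $k\ge 4$, $G^{k,k/2}$ is the hypergraph obtained by replacing each vertex $v$ by a set $\mathbf{v}$ of $k/2$ new vertices (pairwise disjoint sets, called half edges), each edge $\{u,v\}$ ($u\ne v$) by the $k$-edge $\mathbf{u}\cup\mathbf{v}$, and each loop $\{u\}$ by the loop $\mathbf{u}$. The degree of a vertex is the number of edges (loops included) containing it; $d_{\mathbf{u}}$ denotes the common degree of the vertices of $\mathbf{u}$. The adjacency tensor $\mathcal{A}(G^{k,k/2})$ is the order-$k$ tensor indexed by the vertices with entry $1/(k-1)!$ at $(w_1,\dots,w_k)$ whenever $\{w_1,\dots,w_k\}$ is a $k$-element edge and $0$ otherwise (loops ignored); $\mathcal{Q}=\mathcal{D}+\mathcal{A}$ where $\mathcal{D}$ is diagonal with the degrees on the diagonal. $\lambda$ is an eigenvalue of an order-$k$ tensor $\mathcal{T}$ with eigenvector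 $x\neq 0$ if $(\mathcal{T}x^{k-1})_i:=\sum_{i_2,\dots,i_k}t_{ii_2\dots i_k}x_{i_2}\cdots x_{i_k}=\lambda x_i^{k-1}$ for all $i$; it is an $H$-eigenvalue if $x$ can be taken real. For $\mathcal{A}$ this is $\lambda x_w^{k-1}=\sum_{e\ni w,|e|=k}\prod_{z\in e\setminus\{w\}}x_z$, and for $\mathcal{Q}$ it is $(\lambda-d_w)x_w^{k-1}=\sum_{e\ni w,|e|=k}\prod_{z\in e\setminus\{w\}}x_z$. For a vertex set $S$, $x^S:=\prod_{w\in S}x_w$. For the graph $G$, $A(G)$ is the usual adjacency matrix (loops ignored) and $Q(G)=D(G)+A(G)$ with $D(G)$ the diagonal matrix of degrees, where each loop contributes $1$ to the degree of its vertex; thus $d_v(G)=d_{\mathbf{v}}$. -}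

module Defs where

open import Level using (Level; _⊔_) renaming (suc to lsuc)
open import Data.Nat as ℕ using (ℕ; zero; suc; _∸_)
open import Data.Bool using (Bool; true; false; if_then_else_; _∧_; not)
open import Data.Fin using (Fin; zero; suc)
open import Data.Fin.Properties using (_≟_)
open import Data.Product using (_×_; _,_; ∃)
open import Relation.Nullary using (¬_)
open import Relation.Nullary.Decidable using (⌊_⌋)
open import Relation.Binary using (Rel; IsTotalOrder)
open import Relation.Binary.PropositionalEquality using (_≡_)
open import Algebra.Bundles using (CommutativeRing)

-- The real numbers ℝ are an instance.
record OrderedField (c ℓ₁ ℓ₂ : Level) : Set (lsuc (c ⊔ ℓ₁ ⊔ ℓ₂)) where
  field
    commutativeRing : CommutativeRing c ℓ₁
  open CommutativeRing commutativeRing public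
  field
    _≤_          : Rel Carrier ℓ₂
    isTotalOrder : IsTotalOrder _≈_ _≤_
    +-mono-≤     : ∀ {a b} d → a ≤ b → (a + d) ≤ (b + d)
    *-nonneg     : ∀ {a b} → 0# ≤ a → 0# ≤ b → 0# ≤ (a * b)
    1≉0          : ¬ (1# ≈ 0#)
    inverse      : ∀ a → ¬ (a ≈ 0#) → ∃ λ b → (a * b) ≈ 1#

-- A simple graph on vertex set Fin n, possibly with loops:
-- adj u v = true iff {u,v} is an edge; adj u u = true iff there is a loop at u.
record Graph (n : ℕ) : Set where
  field
    adj : Fin n → Fin n → Bool
    sym : ∀ u v → adj u v ≡ adj v u
open Graph public

properAdj : ∀ {n} → Graph n → Fin n → Fin n → Bool
properAdj G u v = adj G u v ∧ not ⌊ u ≟ v ⌋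

count : ∀ {n} → (Fin n → Bool) → ℕ
count {zero}  p = 0
count {suc n} p = (if p zero then 1 else 0) ℕ.+ count (λ i → p (suc i))

-- degree of u in G: number of edges containing u, each loop contributing 1
deg : ∀ {n} → Graph n → Fin n → ℕ
deg G u = count (adj G u)

module Over {c ℓ₁ ℓ₂} (F : OrderedField c ℓ₁ ℓ₂) where
  open OrderedField F public using (Carrier; _≈_; _+_; _*_; _-_; 0#; 1#)

  ι : ℕ → Carrier
  ι zero    = 0#
  ι (suc n) = 1# + ι n

  pow : Carrier → ℕ → Carrier
  pow a zero    = 1#
  pow a (suc e) = a * pow a e

  Σ : ∀ n → (Fin n → Carrier) → Carrier
  Σ zero    f = 0#
  Σ (suc n) f = f zero + Σ n (λ i → f (suc i))

  Π : ∀ n → (Fin n → Carrier) → Carrier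
  Π zero    f = 1#
  Π (suc n) f = f zero * Π n (λ i → f (suc i))

  [_]· : Bool → Carrier → Carrier
  [ b ]· a = if b then a else 0#

  Matrix : ℕ → Set c
  Matrix n = Fin n → Fin n → Carrier

  IsEigenpair : ∀ {n} → Matrix n → Carrier → (Fin n → Carrier) → Set ℓ₁
  IsEigenpair {n} M ℓ y =
    (∃ λ u → ¬ (y u ≈ 0#)) × (∀ u → Σ n (λ v → M u v * y v) ≈ (ℓ * y u))

  adjMat : ∀ {n} → Graph n → Matrix n
  adjMat G u v = [ properAdj G u v ]· 1#

  signlessLap : ∀ {n} → Graph n → Matrix n
  signlessLap G u v = ([ ⌊ u ≟ v ⌋ ]· (ι (deg G u))) + adjMat G u v

  -- The hypergraph G^{k,k/2} with k = 2m: vertex w = (u , i) ∈ Fin n × Fin m,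
  -- half edge 𝐮 = {(u , i) | i : Fin m}.  Its k-edges are 𝐮 ∪ 𝐯 for
  -- each edge {u,v} of G with u ≠ v; its loops are 𝐮 for each loop {u}.
  HVec : ℕ → ℕ → Set c
  HVec n m = Fin n × Fin m → Carrier

  halfProd : ∀ {n m} → HVec n m → Fin n → Carrier
  halfProd {n} {m} x v = Π m (λ j → x (v , j))

  halfProdExcept : ∀ {n m} → HVec n m → Fin n → Fin m → Carrier
  halfProdExcept {n} {m} x u i = Π m (λ j → if ⌊ j ≟ i ⌋ then 1# else x (u , j))

  -- (𝒜 x^{k-1})_w = Σ_{e ∋ w, |e| = k} Π_{z ∈ e ∖ {w}} x_z ;
  -- the k-edges containing w = (u , i) are exactly 𝐮 ∪ 𝐯 with {u,v} ∈ E(G), v ≠ u.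
  hyperAdjApply : ∀ {n m} → Graph n → HVec n m → Fin n × Fin m → Carrier
  hyperAdjApply {n} G x (u , i) =
    Σ n (λ v → [ properAdj G u v ]· (halfProdExcept x u i * halfProd x v))

  -- degree of w = (u , i) in G^{k,k/2}: edges 𝐮 ∪ 𝐯 (v ≠ u adjacent) plus the loop 𝐮
  -- if u has a loop; i.e. the number of v with adj u v.
  hdeg : ∀ {n m} → Graph n → Fin n × Fin m → ℕ
  hdeg G (u , i) = count (adj G u)

  nonzeroVec : ∀ {n m} → HVec n m → Set ℓ₁
  nonzeroVec x = ∃ λ w → ¬ (x w ≈ 0#)

  IsHEigenpairA : ∀ {n} m → Graph n → Carrier → HVec n m → Set ℓ₁
  IsHEigenpairA m G ℓ x =
    nonzeroVec x × (∀ w → (ℓ * pow (x w) (2 ℕ.* m ∸ 1)) ≈ hyperAdjApply G x w)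

  IsHEigenpairQ : ∀ {n} m → Graph n → Carrier → HVec n m → Set ℓ₁
  IsHEigenpairQ m G ℓ x =
    nonzeroVec x ×
    (∀ w → ((ℓ - ι (hdeg G w)) * pow (x w) (2 ℕ.* m ∸ 1)) ≈ hyperAdjApply G x w)

-- Fix a half edge 𝐮 = {(u, i)} and write z_i = x(u, i), P = x^𝐮 and S = (A(G) y)_u.
-- The eigenvalue equation at (u, i) reads μ z_i^{k-1} = (P / z_i) S, where μ = λ
-- (respectively μ = λ - d_𝐮), so μ z_i^k = P S for every i.  Hence the squares z_i²
-- all have the same m-th power (k = 2m); being nonnegative they are equal, so
-- P² = z_0^k and μ P² = P S.  Cancelling P ≠ 0 gives S = μ P, i.e. (A(G) y)_u = μ y_u,
-- which is the adjacency statement, and adding d_u y_u gives the signless Laplacian one.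
module Submission where

open import Defs hiding (sym)
open import Data.Nat as ℕ using (ℕ; zero; suc; _∸_)
import Data.Nat.Properties as ℕ
open import Data.Bool using (Bool; true; false; if_then_else_)
open import Data.Fin using (Fin; zero; suc)
open import Data.Fin.Properties using (_≟_)
open import Data.Product using (_×_; _,_)
open import Data.Sum using (inj₁; inj₂)
open import Relation.Nullary using (¬_; yes; no)
open import Relation.Nullary.Decidable using (⌊_⌋)
open import Relation.Binary.PropositionalEquality as ≡ using (_≡_)
open import Relation.Binary.Structures using (IsTotalOrder)
import Algebra.Properties.CommutativeMonoid.Sum as CommutativeMonoidSum
import Algebra.Properties.CommutativeSemigroup as CommutativeSemigroupProperties
import Algebra.Properties.CommutativeSemiring.Exp as CommutativeSemiringExp
import Algebra.Properties.Group as GroupProperties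
import Algebra.Properties.Ring as RingProperties
import Algebra.Properties.Semiring.Sum as SemiringSum

module HalfEdgeEigenvectors {c ℓ₁ ℓ₂} (F : OrderedField c ℓ₁ ℓ₂) where
  open OrderedField F hiding (zero) renaming (_≤_ to infix 4 _≤_)
  open Over F
    using (ι; pow; Σ; Π; [_]·; halfProd; halfProdExcept; hyperAdjApply;
           IsHEigenpairA; IsHEigenpairQ; IsEigenpair; adjMat; signlessLap; HVec)
  open import Relation.Binary.Reasoning.Setoid setoid
  open IsTotalOrder isTotalOrder
    using (total; antisym; ≤-respˡ-≈; ≤-respʳ-≈)
    renaming (trans to ≤-trans; reflexive to ≤-reflexive)
  open CommutativeMonoidSum +-commutativeMonoid
    using (sum; sum-cong-≋; sum-replicate-zero; ∑-distrib-+)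
  open SemiringSum semiring using (*-distribˡ-sum)
  module Product = CommutativeMonoidSum *-commutativeMonoid
  open CommutativeSemiringExp commutativeSemiring using (_^_; ^-congˡ; ^-distrib-*; ^-homo-*)
  open RingProperties ring using (-‿distribˡ-*; -‿distribʳ-*)
  open GroupProperties +-group using (⁻¹-involutive; x∙y⁻¹≈ε⇒x≈y; //-rightDividesˡ)
  open CommutativeSemigroupProperties *-commutativeSemigroup
    using (interchange; x∙yz≈y∙xz; x∙yz≈yx∙z; xy∙z≈xz∙y; xy∙z≈y∙xz)

  Σ≡sum : ∀ n (f : Fin n → Carrier) → Σ n f ≡ sum f
  Σ≡sum zero    f = ≡.refl
  Σ≡sum (suc n) f = ≡.cong (f zero +_) (Σ≡sum n (λ i → f (suc i)))

  Π≡product : ∀ n (f : Fin n → Carrier) → Π n f ≡ Product.sum f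
  Π≡product zero    f = ≡.refl
  Π≡product (suc n) f = ≡.cong (f zero *_) (Π≡product n (λ i → f (suc i)))

  pow≡^ : ∀ a e → pow a e ≡ a ^ e
  pow≡^ a zero    = ≡.refl
  pow≡^ a (suc e) = ≡.cong (a *_) (pow≡^ a e)

  -- Not definitional: ⌊_⌋ does not compute through the map′ in Fin's _≟_ on an open Dec.
  ⌊suc≟suc⌋ : ∀ {n} (j i : Fin n) → ⌊ suc j ≟ suc i ⌋ ≡ ⌊ j ≟ i ⌋
  ⌊suc≟suc⌋ j i with j ≟ i
  ... | yes _ = ≡.refl
  ... | no  _ = ≡.refl

  Σ-cong : ∀ n {f g : Fin n → Carrier} → (∀ i → f i ≈ g i) → Σ n f ≈ Σ n g
  Σ-cong n {f} {g} f≈g rewrite Σ≡sum n f | Σ≡sum n g = sum-cong-≋ f≈g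

  Σ-distrib-+ : ∀ n (f g : Fin n → Carrier) → Σ n (λ i → f i + g i) ≈ Σ n f + Σ n g
  Σ-distrib-+ n f g rewrite Σ≡sum n (λ i → f i + g i) | Σ≡sum n f | Σ≡sum n g =
    ∑-distrib-+ f g

  *-distribˡ-Σ : ∀ n a (f : Fin n → Carrier) → a * Σ n f ≈ Σ n (λ i → a * f i)
  *-distribˡ-Σ n a f rewrite Σ≡sum n f | Σ≡sum n (λ i → a * f i) = *-distribˡ-sum a f

  Σ-zero : ∀ n → Σ n (λ _ → 0#) ≈ 0#
  Σ-zero n rewrite Σ≡sum n (λ _ → 0#) = sum-replicate-zero n

  Σ-select : ∀ n (u : Fin n) (f : Fin n → Carrier) →
    Σ n (λ v → [ ⌊ u ≟ v ⌋ ]· (f v)) ≈ f u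
  Σ-select (suc n) zero    f = trans (+-congˡ (Σ-zero n)) (+-identityʳ (f zero))
  Σ-select (suc n) (suc u) f = begin
    0# + Σ n (λ v → [ ⌊ suc u ≟ suc v ⌋ ]· (f (suc v)))  ≈⟨ +-identityˡ _ ⟩
    Σ n (λ v → [ ⌊ suc u ≟ suc v ⌋ ]· (f (suc v)))       ≈⟨ Σ-cong n δ-suc ⟩
    Σ n (λ v → [ ⌊ u ≟ v ⌋ ]· (f (suc v)))               ≈⟨ Σ-select n u (λ v → f (suc v)) ⟩
    f (suc u)                                            ∎
    where
      δ-suc : ∀ v → [ ⌊ suc u ≟ suc v ⌋ ]· (f (suc v)) ≈ [ ⌊ u ≟ v ⌋ ]· (f (suc v))
      δ-suc v = reflexive (≡.cong (λ b → [ b ]· (f (suc v))) (⌊suc≟suc⌋ u v))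

  Π-cong : ∀ n {f g : Fin n → Carrier} → (∀ i → f i ≈ g i) → Π n f ≈ Π n g
  Π-cong n {f} {g} f≈g rewrite Π≡product n f | Π≡product n g = Product.sum-cong-≋ f≈g

  Π-distrib-* : ∀ n (f g : Fin n → Carrier) → Π n (λ i → f i * g i) ≈ Π n f * Π n g
  Π-distrib-* n f g rewrite Π≡product n (λ i → f i * g i) | Π≡product n f | Π≡product n g =
    Product.∑-distrib-+ f g

  Π-const : ∀ n a → Π n (λ _ → a) ≈ pow a n
  Π-const n a rewrite Π≡product n (λ _ → a) | pow≡^ a n = Product.sum-replicate n

  Π-except-* : ∀ n (i : Fin n) (f : Fin n → Carrier) →
    Π n (λ j → if ⌊ j ≟ i ⌋ then 1# else f j) * f i ≈ Π n f
  Π-except-* (suc n) zero    f = trans (*-congʳ (*-identityˡ _)) (*-comm _ _)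
  Π-except-* (suc n) (suc i) f = begin
    (f zero * Π n (λ j → if ⌊ suc j ≟ suc i ⌋ then 1# else f (suc j))) * f (suc i)
      ≈⟨ *-assoc _ _ _ ⟩
    f zero * (Π n (λ j → if ⌊ suc j ≟ suc i ⌋ then 1# else f (suc j)) * f (suc i))
      ≈⟨ *-congˡ (*-congʳ (Π-cong n δ-suc)) ⟩
    f zero * (Π n (λ j → if ⌊ j ≟ i ⌋ then 1# else f (suc j)) * f (suc i))
      ≈⟨ *-congˡ (Π-except-* n i (λ j → f (suc j))) ⟩
    f zero * Π n (λ j → f (suc j))
      ∎
    where
      δ-suc : ∀ j → (if ⌊ suc j ≟ suc i ⌋ then 1# else f (suc j))
                  ≈ (if ⌊ j ≟ i ⌋ then 1# else f (suc j))
      δ-suc j = reflexive (≡.cong (λ b → if b then 1# else f (suc j)) (⌊suc≟suc⌋ j i))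

  pow-cong : ∀ e {a b} → a ≈ b → pow a e ≈ pow b e
  pow-cong e {a} {b} a≈b rewrite pow≡^ a e | pow≡^ b e = ^-congˡ e a≈b

  pow-distrib-* : ∀ a b e → pow (a * b) e ≈ pow a e * pow b e
  pow-distrib-* a b e rewrite pow≡^ (a * b) e | pow≡^ a e | pow≡^ b e = ^-distrib-* a b e

  pow-square : ∀ a e → pow (a * a) e ≈ pow a (2 ℕ.* e)
  pow-square a e rewrite ℕ.+-identityʳ e | pow≡^ (a * a) e | pow≡^ a (e ℕ.+ e) =
    trans (^-distrib-* a a e) (sym (^-homo-* a e e))

  pow-1# : ∀ e → pow 1# e ≈ 1#
  pow-1# zero    = refl
  pow-1# (suc e) = trans (*-identityˡ _) (pow-1# e)

  *-cancelˡ-nonzero : ∀ {a b d} → ¬ a ≈ 0# → a * b ≈ a * d → b ≈ d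
  *-cancelˡ-nonzero {a} {b} {d} a≉0 ab≈ad with inverse a a≉0
  ... | a⁻¹ , aa⁻¹≈1 = begin
    b              ≈⟨ *-identityˡ b ⟨
    1# * b         ≈⟨ *-congʳ aa⁻¹≈1 ⟨
    (a * a⁻¹) * b  ≈⟨ xy∙z≈xz∙y a a⁻¹ b ⟩
    (a * b) * a⁻¹  ≈⟨ *-congʳ ab≈ad ⟩
    (a * d) * a⁻¹  ≈⟨ xy∙z≈xz∙y a d a⁻¹ ⟩
    (a * a⁻¹) * d  ≈⟨ *-congʳ aa⁻¹≈1 ⟩
    1# * d         ≈⟨ *-identityˡ d ⟩
    d              ∎

  *-nonzero : ∀ {a b} → ¬ a ≈ 0# → ¬ b ≈ 0# → ¬ a * b ≈ 0#
  *-nonzero {a} a≉0 b≉0 ab≈0 = b≉0 (*-cancelˡ-nonzero a≉0 (trans ab≈0 (sym (zeroʳ a))))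

  Π-nonzero : ∀ n (f : Fin n → Carrier) → (∀ i → ¬ f i ≈ 0#) → ¬ Π n f ≈ 0#
  Π-nonzero zero    f f≉0 = 1≉0
  Π-nonzero (suc n) f f≉0 =
    *-nonzero (f≉0 zero) (Π-nonzero n (λ i → f (suc i)) (λ i → f≉0 (suc i)))

  x*x-nonneg : ∀ a → 0# ≤ a * a
  x*x-nonneg a with total 0# a
  ... | inj₁ 0≤a = *-nonneg 0≤a 0≤a
  ... | inj₂ a≤0 = ≤-respʳ-≈ -a*-a≈a*a (*-nonneg 0≤-a 0≤-a)
    where
      0≤-a : 0# ≤ - a
      0≤-a = ≤-respˡ-≈ (-‿inverseʳ a) (≤-respʳ-≈ (+-identityˡ (- a)) (+-mono-≤ (- a) a≤0))
      -a*-a≈a*a : - a * - a ≈ a * a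
      -a*-a≈a*a = begin
        - a * - a      ≈⟨ -‿distribˡ-* a (- a) ⟨
        - (a * - a)    ≈⟨ -‿cong (-‿distribʳ-* a a) ⟨
        - (- (a * a))  ≈⟨ ⁻¹-involutive (a * a) ⟩
        a * a          ∎

  *-monoˡ-≤-nonneg : ∀ {a b d} → 0# ≤ a → b ≤ d → a * b ≤ a * d
  *-monoˡ-≤-nonneg {a} {b} {d} 0≤a b≤d =
    ≤-respˡ-≈ (+-identityˡ (a * b)) (≤-respʳ-≈ a[d-b]+ab≈ad (+-mono-≤ (a * b) 0≤a[d-b]))
    where
      0≤a[d-b] : 0# ≤ a * (d - b)
      0≤a[d-b] = *-nonneg 0≤a (≤-respˡ-≈ (-‿inverseʳ b) (+-mono-≤ (- b) b≤d))
      a[d-b]+ab≈ad : a * (d - b) + a * b ≈ a * d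
      a[d-b]+ab≈ad = trans (sym (distribˡ a (d - b) b)) (*-congˡ (//-rightDividesˡ b d))

  pow-≤1 : ∀ {a} e → 0# ≤ a → a ≤ 1# → pow a e ≤ 1#
  pow-≤1 zero    0≤a a≤1 = ≤-reflexive refl
  pow-≤1 {a} (suc e) 0≤a a≤1 =
    ≤-trans (*-monoˡ-≤-nonneg 0≤a (pow-≤1 e 0≤a a≤1)) (≤-respˡ-≈ (sym (*-identityʳ a)) a≤1)

  pow-≥1 : ∀ {a} e → 0# ≤ a → 1# ≤ a → 1# ≤ pow a e
  pow-≥1 zero    0≤a 1≤a = ≤-reflexive refl
  pow-≥1 {a} (suc e) 0≤a 1≤a =
    ≤-trans 1≤a (≤-respˡ-≈ (*-identityʳ a) (*-monoˡ-≤-nonneg 0≤a (pow-≥1 e 0≤a 1≤a)))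

  pow≈1⇒≈1 : ∀ {a} k → 0# ≤ a → pow a (suc k) ≈ 1# → a ≈ 1#
  pow≈1⇒≈1 {a} k 0≤a aᵏ⁺¹≈1 with total a 1#
  ... | inj₁ a≤1 = antisym a≤1 (≤-respˡ-≈ aᵏ⁺¹≈1 aᵏ⁺¹≤a)
    where
      aᵏ⁺¹≤a : pow a (suc k) ≤ a
      aᵏ⁺¹≤a = ≤-respʳ-≈ (*-identityʳ a) (*-monoˡ-≤-nonneg 0≤a (pow-≤1 k 0≤a a≤1))
  ... | inj₂ 1≤a = antisym (≤-respʳ-≈ aᵏ⁺¹≈1 a≤aᵏ⁺¹) 1≤a
    where
      a≤aᵏ⁺¹ : a ≤ pow a (suc k)
      a≤aᵏ⁺¹ = ≤-respˡ-≈ (*-identityʳ a) (*-monoˡ-≤-nonneg 0≤a (pow-≥1 k 0≤a 1≤a))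

  pow-injective : ∀ k {a b} → ¬ a ≈ 0# → 0# ≤ a * b → pow a (suc k) ≈ pow b (suc k) → a ≈ b
  pow-injective k {a} {b} a≉0 0≤ab aᵏ⁺¹≈bᵏ⁺¹ with inverse a a≉0
  ... | a⁻¹ , aa⁻¹≈1 = begin
    a               ≈⟨ *-identityˡ a ⟨
    1# * a          ≈⟨ *-congʳ (pow≈1⇒≈1 k 0≤ba⁻¹ [ba⁻¹]ᵏ⁺¹≈1) ⟨
    (b * a⁻¹) * a   ≈⟨ xy∙z≈xz∙y b a⁻¹ a ⟩
    (b * a) * a⁻¹   ≈⟨ *-congʳ (*-comm b a) ⟩
    (a * b) * a⁻¹   ≈⟨ xy∙z≈y∙xz a b a⁻¹ ⟩
    b * (a * a⁻¹)   ≈⟨ *-congˡ aa⁻¹≈1 ⟩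
    b * 1#          ≈⟨ *-identityʳ b ⟩
    b               ∎
    where
      0≤ba⁻¹ : 0# ≤ b * a⁻¹
      0≤ba⁻¹ = ≤-respʳ-≈ ab[a⁻¹a⁻¹]≈ba⁻¹ (*-nonneg 0≤ab (x*x-nonneg a⁻¹))
        where
          ab[a⁻¹a⁻¹]≈ba⁻¹ : (a * b) * (a⁻¹ * a⁻¹) ≈ b * a⁻¹
          ab[a⁻¹a⁻¹]≈ba⁻¹ = begin
            (a * b) * (a⁻¹ * a⁻¹)  ≈⟨ interchange a b a⁻¹ a⁻¹ ⟩
            (a * a⁻¹) * (b * a⁻¹)  ≈⟨ *-congʳ aa⁻¹≈1 ⟩
            1# * (b * a⁻¹)         ≈⟨ *-identityˡ _ ⟩
            b * a⁻¹                ∎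
      [ba⁻¹]ᵏ⁺¹≈1 : pow (b * a⁻¹) (suc k) ≈ 1#
      [ba⁻¹]ᵏ⁺¹≈1 = begin
        pow (b * a⁻¹) (suc k)           ≈⟨ pow-distrib-* b a⁻¹ (suc k) ⟩
        pow b (suc k) * pow a⁻¹ (suc k) ≈⟨ *-congʳ aᵏ⁺¹≈bᵏ⁺¹ ⟨
        pow a (suc k) * pow a⁻¹ (suc k) ≈⟨ pow-distrib-* a a⁻¹ (suc k) ⟨
        pow (a * a⁻¹) (suc k)           ≈⟨ pow-cong (suc k) aa⁻¹≈1 ⟩
        pow 1# (suc k)                  ≈⟨ pow-1# (suc k) ⟩
        1#                              ∎

  halfEdge-balance : ∀ k {μ S} (z : Fin (suc k) → Carrier) →
    ¬ μ ≈ 0# → (∀ i → ¬ z i ≈ 0#) →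
    (∀ i → μ * pow (z i) (2 ℕ.* suc k ∸ 1)
             ≈ Π (suc k) (λ j → if ⌊ j ≟ i ⌋ then 1# else z j) * S) →
    S ≈ μ * Π (suc k) z
  halfEdge-balance k {μ} {S} z μ≉0 z≉0 eigen = sym (*-cancelˡ-nonzero P≉0 (begin
    P * (μ * P)                       ≈⟨ x∙yz≈y∙xz P μ P ⟩
    μ * (P * P)                       ≈⟨ *-congˡ (Π-distrib-* m z z) ⟨
    μ * Π m (λ i → z i * z i)         ≈⟨ *-congˡ (Π-cong m zᵢ²≈z₀²) ⟨
    μ * Π m (λ _ → z zero * z zero)   ≈⟨ *-congˡ (Π-const m (z zero * z zero)) ⟩
    μ * pow (z zero * z zero) m       ≈⟨ *-congˡ (pow-square (z zero) m) ⟩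
    μ * pow (z zero) (2 ℕ.* m)        ≈⟨ μzᵢ²ᵐ≈PS zero ⟩
    P * S                             ∎))
    where
      m = suc k
      P = Π m z
      P≉0 : ¬ P ≈ 0#
      P≉0 = Π-nonzero m z z≉0
      E : Fin m → Carrier
      E i = Π m (λ j → if ⌊ j ≟ i ⌋ then 1# else z j)
      -- Since m ≥ 1, pow (z i) (2 ℕ.* m) unfolds to z i * pow (z i) (2 ℕ.* m ∸ 1).
      μzᵢ²ᵐ≈PS : ∀ i → μ * pow (z i) (2 ℕ.* m) ≈ P * S
      μzᵢ²ᵐ≈PS i = begin
        μ * (z i * pow (z i) (2 ℕ.* m ∸ 1))  ≈⟨ x∙yz≈y∙xz μ (z i) _ ⟩
        z i * (μ * pow (z i) (2 ℕ.* m ∸ 1))  ≈⟨ *-congˡ (eigen i) ⟩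
        z i * (E i * S)                      ≈⟨ x∙yz≈yx∙z (z i) (E i) S ⟩
        (E i * z i) * S                      ≈⟨ *-congʳ (Π-except-* m i z) ⟩
        P * S                                ∎
      zᵢ²≈z₀² : ∀ i → z zero * z zero ≈ z i * z i
      zᵢ²≈z₀² i = pow-injective k (*-nonzero (z≉0 zero) (z≉0 zero))
        (*-nonneg (x*x-nonneg (z zero)) (x*x-nonneg (z i))) (begin
          pow (z zero * z zero) m  ≈⟨ pow-square (z zero) m ⟩
          pow (z zero) (2 ℕ.* m)   ≈⟨ *-cancelˡ-nonzero μ≉0 (trans (μzᵢ²ᵐ≈PS zero)
                                                                 (sym (μzᵢ²ᵐ≈PS i))) ⟩
          pow (z i) (2 ℕ.* m)      ≈⟨ pow-square (z i) m ⟨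
          pow (z i * z i) m        ∎)

  []·-*ˡ : ∀ (b : Bool) a y → [ b ]· a * y ≈ [ b ]· (a * y)
  []·-*ˡ true  a y = refl
  []·-*ˡ false a y = zeroˡ y

  []·-factor : ∀ (b : Bool) a y → [ b ]· (a * y) ≈ a * ([ b ]· 1# * y)
  []·-factor true  a y = *-congˡ (sym (*-identityˡ y))
  []·-factor false a y = sym (trans (*-congˡ (zeroˡ y)) (zeroʳ a))

  hyperAdjApply-factor : ∀ {n m} (G : Graph n) (x : HVec n m) u i →
    hyperAdjApply G x (u , i) ≈ halfProdExcept x u i * Σ n (λ v → adjMat G u v * halfProd x v)
  hyperAdjApply-factor {n} G x u i = trans
    (Σ-cong n (λ v → []·-factor (properAdj G u v) (halfProdExcept x u i) (halfProd x v)))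
    (sym (*-distribˡ-Σ n (halfProdExcept x u i) (λ v → adjMat G u v * halfProd x v)))

  adjMat-halfProd-row : ∀ k {n} (G : Graph n) (x : HVec n (suc k)) {μ} u → ¬ μ ≈ 0# →
    (∀ i → ¬ x (u , i) ≈ 0#) →
    (∀ i → μ * pow (x (u , i)) (2 ℕ.* suc k ∸ 1) ≈ hyperAdjApply G x (u , i)) →
    Σ n (λ v → adjMat G u v * halfProd x v) ≈ μ * halfProd x u
  adjMat-halfProd-row k G x u μ≉0 x≉0 eigen =
    halfEdge-balance k (λ j → x (u , j)) μ≉0 x≉0
      (λ i → trans (eigen i) (hyperAdjApply-factor G x u i))

  signlessLap-row : ∀ {n} (G : Graph n) (y : Fin n → Carrier) u →
    Σ n (λ v → signlessLap G u v * y v) ≈ ι (deg G u) * y u + Σ n (λ v → adjMat G u v * y v)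
  signlessLap-row {n} G y u = begin
    Σ n (λ v → ([ ⌊ u ≟ v ⌋ ]· d + adjMat G u v) * y v)
      ≈⟨ Σ-cong n (λ v → distribʳ (y v) _ _) ⟩
    Σ n (λ v → [ ⌊ u ≟ v ⌋ ]· d * y v + adjMat G u v * y v)
      ≈⟨ Σ-distrib-+ n _ _ ⟩
    Σ n (λ v → [ ⌊ u ≟ v ⌋ ]· d * y v) + Σ n (λ v → adjMat G u v * y v)
      ≈⟨ +-congʳ (Σ-cong n (λ v → []·-*ˡ ⌊ u ≟ v ⌋ d (y v))) ⟩
    Σ n (λ v → [ ⌊ u ≟ v ⌋ ]· (d * y v)) + Σ n (λ v → adjMat G u v * y v)
      ≈⟨ +-congʳ (Σ-select n u (λ v → d * y v)) ⟩
    d * y u + Σ n (λ v → adjMat G u v * y v)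
      ∎
    where d = ι (deg G u)

  halfProd-nonzero : ∀ {n m} (x : HVec n m) → (∀ w → ¬ x w ≈ 0#) →
    ∀ u → ¬ halfProd x u ≈ 0#
  halfProd-nonzero {m = m} x x≉0 u = Π-nonzero m (λ j → x (u , j)) (λ j → x≉0 (u , j))

  adjMat-eigenpair : ∀ k {n} (G : Graph n) ℓ (x : HVec n (suc k)) →
    IsHEigenpairA (suc k) G ℓ x → (∀ w → ¬ x w ≈ 0#) → ¬ ℓ ≈ 0# →
    IsEigenpair (adjMat G) ℓ (halfProd x)
  adjMat-eigenpair k G ℓ x (((u , _) , _) , eigen) x≉0 ℓ≉0 =
    (u , halfProd-nonzero x x≉0 u) ,
    λ v → adjMat-halfProd-row k G x v ℓ≉0 (λ i → x≉0 (v , i)) (λ i → eigen (v , i))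

  signlessLap-eigenpair : ∀ k {n} (G : Graph n) ℓ (x : HVec n (suc k)) →
    IsHEigenpairQ (suc k) G ℓ x → (∀ w → ¬ x w ≈ 0#) → (∀ u → ¬ ℓ ≈ ι (deg G u)) →
    IsEigenpair (signlessLap G) ℓ (halfProd x)
  signlessLap-eigenpair k {n} G ℓ x (((u , _) , _) , eigen) x≉0 ℓ≉d =
    (u , halfProd-nonzero x x≉0 u) , row
    where
      y = halfProd x
      row : ∀ v → Σ n (λ w → signlessLap G v w * y w) ≈ ℓ * y v
      row v = begin
        Σ n (λ w → signlessLap G v w * y w)         ≈⟨ signlessLap-row G y v ⟩
        d * y v + Σ n (λ w → adjMat G v w * y w)    ≈⟨ +-congˡ adjacencyRow ⟩
        d * y v + (ℓ - d) * y v                     ≈⟨ distribʳ (y v) d (ℓ - d) ⟨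
        (d + (ℓ - d)) * y v                         ≈⟨ *-congʳ d+[ℓ-d]≈ℓ ⟩
        ℓ * y v                                     ∎
        where
          d = ι (deg G v)
          d+[ℓ-d]≈ℓ : d + (ℓ - d) ≈ ℓ
          d+[ℓ-d]≈ℓ = trans (+-comm d (ℓ - d)) (//-rightDividesˡ d ℓ)
          ℓ-d≉0 : ¬ ℓ - d ≈ 0#
          ℓ-d≉0 ℓ-d≈0 = ℓ≉d v (x∙y⁻¹≈ε⇒x≈y ℓ d ℓ-d≈0)
          adjacencyRow : Σ n (λ w → adjMat G v w * y w) ≈ (ℓ - d) * y v
          adjacencyRow =
            adjMat-halfProd-row k G x v ℓ-d≉0 (λ i → x≉0 (v , i)) (λ i → eigen (v , i))

open import Data.Nat using (_≤_; s≤s)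
open HalfEdgeEigenvectors using (adjMat-eigenpair; signlessLap-eigenpair)

corollary3p2 : ∀ {c ℓ₁ ℓ₂} (F : OrderedField c ℓ₁ ℓ₂) →
    let open Over F in
    (m : ℕ) → 2 ≤ m → (n : ℕ) → (G : Graph n) →
      ((ℓ : Carrier) (x : HVec n m) →
        IsHEigenpairA m G ℓ x → (∀ w → ¬ (x w ≈ 0#)) → ¬ (ℓ ≈ 0#) →
        IsEigenpair (adjMat G) ℓ (halfProd x))
    × ((ℓ : Carrier) (x : HVec n m) →
        IsHEigenpairQ m G ℓ x → (∀ w → ¬ (x w ≈ 0#)) →
        (∀ (u : Fin n) → ¬ (ℓ ≈ ι (deg G u))) →
        IsEigenpair (signlessLap G) ℓ (halfProd x))
-- The argument only needs m ≥ 1.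
corollary3p2 F (suc k) (s≤s _) n G = adjMat-eigenpair F k G , signlessLap-eigenpair F k G
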